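{- Let $n\ge 3$ be an integer, $1\le x\le n-2$, and $\left\lfloor \frac{n}{n-x+1}\right\rfloor\le k\le x$. Then $$F_n(x,k)=\sum_{i=0}^{k-1}F_{n-i-1}(x-i,k)+\sum_{j=0}^{k}F_{n-k-1}(x-k,j).$$
   Context: For integers $n\ge 0$ and $x,k\ge 0$, $B_n^{x,k}$ denotes the set of binary strings of length $n$ that contain exactly $x$ zeros and in which the longest block of consecutive zeros has length exactly $k$ (the all-ones string, including the empty string for $n=0$, lies in $B_n^{0,0}$). $F_n(x,k)=|B_n^{x,k}|$; in particular $F_n(x,k)=0$ whenever no such string exists (e.g. $x>n$ or $k>x$), and $F_n(x,k)=0$ for $n<0$. -}

module Defs where

open import Data.Bool using (Bool; true; false)
open import Data.Nat using (ℕ; zero; suc; _+_; _⊔_; _≡ᵇ_)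
open import Data.List using (List; []; _∷_; map; _++_; length; filter; upTo)
open import Data.Nat.ListAction using (sum)
open import Data.Vec using (Vec; []; _∷_)
open import Data.Product using (_×_; _,_)
open import Relation.Nullary.Decidable using (Dec; _×-dec_)
open import Relation.Binary.PropositionalEquality using (_≡_)
import Data.Nat as ℕ

-- Binary strings of length n: Vec Bool n, with false = 0 and true = 1.
-- All 2^n binary strings of length n.
allStrings : (n : ℕ) → List (Vec Bool n)
allStrings zero    = [] ∷ []
allStrings (suc n) = map (false ∷_) (allStrings n) ++ map (true ∷_) (allStrings n)

zeros : ∀ {n} → Vec Bool n → ℕ
zeros []          = 0
zeros (false ∷ v) = suc (zeros v)
zeros (true ∷ v)  = zeros v

-- longest block of consecutive zeros; `cur` is the length of the current
-- zero block ending just before the remaining suffix, `best` the maximum so far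
longestRun : ∀ {n} → ℕ → ℕ → Vec Bool n → ℕ
longestRun cur best []          = best ⊔ cur
longestRun cur best (false ∷ v) = longestRun (suc cur) best v
longestRun cur best (true ∷ v)  = longestRun 0 (best ⊔ cur) v

maxZeroBlock : ∀ {n} → Vec Bool n → ℕ
maxZeroBlock v = longestRun 0 0 v

InB : ∀ {n} → ℕ → ℕ → Vec Bool n → Set
InB x k v = (zeros v ≡ x) × (maxZeroBlock v ≡ k)

inB? : ∀ {n} (x k : ℕ) (v : Vec Bool n) → Dec (InB x k v)
inB? x k v = (zeros v ℕ.≟ x) ×-dec (maxZeroBlock v ℕ.≟ k)

-- F_n(x,k) = |B_n^{x,k}|  (for natural n; the paper's convention F_n = 0 for
-- n < 0 never arises in the theorem since all indices there are ≥ 0)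
F : ℕ → ℕ → ℕ → ℕ
F n x k = length (filter (inB? x k) (allStrings n))

Σ[0to_] : ℕ → (ℕ → ℕ) → ℕ
Σ[0to m ] f = sum (map f (upTo (suc m)))

-- A string counted by F_n(x,k) (with x ≤ n-2, so it contains a one) starts
-- with a block 0^i 1 with i ≤ k.  If i < k, the rest is an arbitrary string
-- of length n-i-1 with x-i zeros and longest zero block exactly k; if i = k,
-- the rest has x-k zeros and longest zero block j for some j ≤ k.  Summing
-- over these disjoint cases gives the formula.
--
-- To make this an induction we count, for a fixed target k, the strings w
-- whose longest zero block is k once a block of i zeros is prepended
-- ('prefixedCount').  Reading the first letter of w either lengthens the
-- prepended block (letter 0) or closes it (letter 1); unrolling this step
-- from i = 0 up to i = k yields the theorem.
module Submission where

open import Defs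
open import Data.Nat using (ℕ; suc; _+_; _∸_; _≤_; _/_)
open import Relation.Binary.PropositionalEquality using (_≡_)

open import Data.Nat using (zero; _<_; _⊔_; _≡ᵇ_; s≤s)
open import Data.Nat.Properties
open import Data.Nat.DivMod using (m≥n⇒m/n>0)
open import Data.Nat.ListAction using (sum)
open import Data.Bool using (Bool; true; false; T; _∧_; _∨_; if_then_else_)
open import Data.Bool.Properties using (∧-zeroʳ; ∧-distribˡ-∨)
open import Data.List using (List; []; _∷_; map; _++_; length; filter; applyUpTo)
open import Data.List.Properties using (length-++; filter-++)
open import Data.Vec using (Vec; []; _∷_)
open import Data.Empty using (⊥-elim)
open import Relation.Nullary using (does; ¬_)
open import Relation.Unary using (Decidable)
open import Relation.Binary.PropositionalEquality using (refl; sym; trans; cong; cong₂; subst; module ≡-Reasoning)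
open import Function using (_∘_)

count : (n : ℕ) → (Vec Bool n → Bool) → ℕ
count zero    p = if p [] then 1 else 0
count (suc n) p = count n (λ v → p (false ∷ v)) + count n (λ v → p (true ∷ v))

count-ext : ∀ n (p q : Vec Bool n → Bool) → (∀ v → p v ≡ q v) → count n p ≡ count n q
count-ext zero    p q p≗q rewrite p≗q [] = refl
count-ext (suc n) p q p≗q =
  cong₂ _+_ (count-ext n _ _ (p≗q ∘ (false ∷_))) (count-ext n _ _ (p≗q ∘ (true ∷_)))

count-none : ∀ n (p : Vec Bool n → Bool) → (∀ v → p v ≡ false) → count n p ≡ 0
count-none zero    p never rewrite never [] = refl
count-none (suc n) p never =
  cong₂ _+_ (count-none n _ (never ∘ (false ∷_))) (count-none n _ (never ∘ (true ∷_)))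

count-∨ : ∀ n (a b : Vec Bool n → Bool) → (∀ v → a v ∧ b v ≡ false) →
          count n (λ v → a v ∨ b v) ≡ count n a + count n b
count-∨ zero a b disjoint with a [] | b [] | disjoint []
... | false | false | _ = refl
... | false | true  | _ = refl
... | true  | false | _ = refl
count-∨ (suc n) a b disjoint = begin
  count n (λ v → a (false ∷ v) ∨ b (false ∷ v)) + count n (λ v → a (true ∷ v) ∨ b (true ∷ v))
    ≡⟨ cong₂ _+_ (count-∨ n _ _ (disjoint ∘ (false ∷_))) (count-∨ n _ _ (disjoint ∘ (true ∷_))) ⟩
  (a₀ + b₀) + (a₁ + b₁)
    ≡⟨ +-assoc a₀ b₀ (a₁ + b₁) ⟩
  a₀ + (b₀ + (a₁ + b₁))
    ≡⟨ cong (a₀ +_) (+-comm b₀ (a₁ + b₁)) ⟩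
  a₀ + ((a₁ + b₁) + b₀)
    ≡⟨ cong (a₀ +_) (+-assoc a₁ b₁ b₀) ⟩
  a₀ + (a₁ + (b₁ + b₀))
    ≡⟨ sym (+-assoc a₀ a₁ (b₁ + b₀)) ⟩
  (a₀ + a₁) + (b₁ + b₀)
    ≡⟨ cong ((a₀ + a₁) +_) (+-comm b₁ b₀) ⟩
  (a₀ + a₁) + (b₀ + b₁) ∎
  where
  open ≡-Reasoning
  a₀ = count n (λ v → a (false ∷ v))
  b₀ = count n (λ v → b (false ∷ v))
  a₁ = count n (λ v → a (true ∷ v))
  b₁ = count n (λ v → b (true ∷ v))

length-filter-map : ∀ {m n} {P : Vec Bool n → Set} (P? : Decidable P)
  (f : Vec Bool m → Vec Bool n) (vs : List (Vec Bool m)) →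
  length (filter P? (map f vs)) ≡ length (filter (P? ∘ f) vs)
length-filter-map P? f []       = refl
length-filter-map P? f (v ∷ vs) with does (P? (f v))
... | true  = cong suc (length-filter-map P? f vs)
... | false = length-filter-map P? f vs

length-filter-allStrings : ∀ n {P : Vec Bool n → Set} (P? : Decidable P) →
  length (filter P? (allStrings n)) ≡ count n (does ∘ P?)
length-filter-allStrings zero    P? with does (P? [])
... | true  = refl
... | false = refl
length-filter-allStrings (suc n) P? = begin
  length (filter P? (map (false ∷_) vs ++ map (true ∷_) vs))
    ≡⟨ cong length (filter-++ P? (map (false ∷_) vs) (map (true ∷_) vs)) ⟩
  length (filter P? (map (false ∷_) vs) ++ filter P? (map (true ∷_) vs))
    ≡⟨ length-++ (filter P? (map (false ∷_) vs)) ⟩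
  length (filter P? (map (false ∷_) vs)) + length (filter P? (map (true ∷_) vs))
    ≡⟨ cong₂ _+_ (trans (length-filter-map P? (false ∷_) vs) (length-filter-allStrings n _))
                 (trans (length-filter-map P? (true ∷_) vs) (length-filter-allStrings n _)) ⟩
  count (suc n) (does ∘ P?) ∎
  where
  open ≡-Reasoning
  vs = allStrings n

hasShape : ∀ {m} → ℕ → ℕ → Vec Bool m → Bool
hasShape x k w = (zeros w ≡ᵇ x) ∧ (maxZeroBlock w ≡ᵇ k)

-- F as a count ('does' of the decision 'inB?' computes to 'hasShape').
F≡count : ∀ m x k → F m x k ≡ count m (hasShape x k)
F≡count m x k = length-filter-allStrings m (inB? x k)

Σ< : ℕ → (ℕ → ℕ) → ℕ
Σ< zero    f = 0
Σ< (suc d) f = f 0 + Σ< d (f ∘ suc)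

sum-map-applyUpTo : ∀ d (f g : ℕ → ℕ) → sum (map f (applyUpTo g d)) ≡ Σ< d (f ∘ g)
sum-map-applyUpTo zero    f g = refl
sum-map-applyUpTo (suc d) f g = cong (f (g 0) +_) (sum-map-applyUpTo d f (g ∘ suc))

Σ[0to]≡Σ< : ∀ m f → Σ[0to m ] f ≡ Σ< (suc m) f
Σ[0to]≡Σ< m f = sum-map-applyUpTo (suc m) f (λ i → i)

Σ<-snoc : ∀ d f → Σ< (suc d) f ≡ Σ< d f + f d
Σ<-snoc zero    f = +-comm (f 0) 0
Σ<-snoc (suc d) f = trans (cong (f 0 +_) (Σ<-snoc d (f ∘ suc))) (sym (+-assoc (f 0) _ _))

longestRun-best : ∀ {n} c b (v : Vec Bool n) → longestRun c b v ≡ b ⊔ longestRun c 0 v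
longestRun-best c b []          = refl
longestRun-best c b (false ∷ v) = longestRun-best (suc c) b v
longestRun-best c b (true ∷ v)  = begin
  longestRun 0 (b ⊔ c) v   ≡⟨ longestRun-best 0 (b ⊔ c) v ⟩
  b ⊔ c ⊔ longestRun 0 0 v ≡⟨ ⊔-assoc b c _ ⟩
  b ⊔ (c ⊔ longestRun 0 0 v) ≡⟨ cong (b ⊔_) (sym (longestRun-best 0 c v)) ⟩
  b ⊔ longestRun 0 c v     ∎
  where open ≡-Reasoning

current≤longestRun : ∀ {n} c b (v : Vec Bool n) → c ≤ longestRun c b v
current≤longestRun c b []          = m≤n⊔m b c
current≤longestRun c b (false ∷ v) = ≤-trans (n≤1+n c) (current≤longestRun (suc c) b v)
current≤longestRun c b (true ∷ v)  = begin
  c                            ≤⟨ m≤n⊔m b c ⟩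
  b ⊔ c                        ≤⟨ m≤m⊔n (b ⊔ c) _ ⟩
  b ⊔ c ⊔ longestRun 0 0 v     ≡⟨ sym (longestRun-best 0 (b ⊔ c) v) ⟩
  longestRun 0 (b ⊔ c) v       ∎
  where open ≤-Reasoning

≡ᵇ-refl : ∀ k → (k ≡ᵇ k) ≡ true
≡ᵇ-refl zero    = refl
≡ᵇ-refl (suc k) = ≡ᵇ-refl k

≢⇒≡ᵇ-false : ∀ {m n} → ¬ m ≡ n → (m ≡ᵇ n) ≡ false
≢⇒≡ᵇ-false {m} {n} m≢n with m ≡ᵇ n in eq
... | false = refl
... | true  = ⊥-elim (m≢n (≡ᵇ⇒≡ m n (subst T (sym eq) _)))

-- "M ≤ suc K" (written suc K ⊔ M = suc K) is "M ≤ K or M = suc K" …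
⊔≡ᵇ-suc : ∀ K M → (suc K ⊔ M ≡ᵇ suc K) ≡ ((K ⊔ M ≡ᵇ K) ∨ (M ≡ᵇ suc K))
⊔≡ᵇ-suc zero    zero    = refl
⊔≡ᵇ-suc (suc K) zero    rewrite ≡ᵇ-refl K = refl
⊔≡ᵇ-suc zero    (suc M) = refl
⊔≡ᵇ-suc (suc K) (suc M) = ⊔≡ᵇ-suc K M

⊔≡ᵇ-disjoint : ∀ K M → ((K ⊔ M ≡ᵇ K) ∧ (M ≡ᵇ suc K)) ≡ false
⊔≡ᵇ-disjoint K       zero    = ∧-zeroʳ _
⊔≡ᵇ-disjoint zero    (suc M) = refl
⊔≡ᵇ-disjoint (suc K) (suc M) = ⊔≡ᵇ-disjoint K M

⊔≡ᵇ-below : ∀ i M k → i < k → (i ⊔ M ≡ᵇ k) ≡ (M ≡ᵇ k)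
⊔≡ᵇ-below zero    M       k       _         = refl
⊔≡ᵇ-below (suc i) zero    (suc k) (s≤s i<k) = ≢⇒≡ᵇ-false (<⇒≢ i<k)
⊔≡ᵇ-below (suc i) (suc M) (suc k) (s≤s i<k) = ⊔≡ᵇ-below i M k i<k

count-maxZeroBlock≤ : ∀ m y K →
  count m (λ w → (zeros w ≡ᵇ y) ∧ (K ⊔ maxZeroBlock w ≡ᵇ K)) ≡ Σ< (suc K) (F m y)
count-maxZeroBlock≤ m y zero = trans (sym (F≡count m y 0)) (+-comm 0 _)
count-maxZeroBlock≤ m y (suc K) = begin
  count m (λ w → (zeros w ≡ᵇ y) ∧ (suc K ⊔ maxZeroBlock w ≡ᵇ suc K))
    ≡⟨ count-ext m _ _ split ⟩
  count m (λ w → atMostK w ∨ hasShape y (suc K) w)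
    ≡⟨ count-∨ m atMostK (hasShape y (suc K)) disjoint ⟩
  count m atMostK + count m (hasShape y (suc K))
    ≡⟨ cong₂ _+_ (count-maxZeroBlock≤ m y K) (sym (F≡count m y (suc K))) ⟩
  Σ< (suc K) (F m y) + F m y (suc K)
    ≡⟨ sym (Σ<-snoc (suc K) (F m y)) ⟩
  Σ< (suc (suc K)) (F m y) ∎
  where
  open ≡-Reasoning
  atMostK : Vec Bool m → Bool
  atMostK w = (zeros w ≡ᵇ y) ∧ (K ⊔ maxZeroBlock w ≡ᵇ K)
  split : ∀ w → (zeros w ≡ᵇ y) ∧ (suc K ⊔ maxZeroBlock w ≡ᵇ suc K)
              ≡ atMostK w ∨ hasShape y (suc K) w
  split w = trans (cong ((zeros w ≡ᵇ y) ∧_) (⊔≡ᵇ-suc K (maxZeroBlock w)))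
                  (∧-distribˡ-∨ (zeros w ≡ᵇ y) _ _)
  disjoint : ∀ w → atMostK w ∧ hasShape y (suc K) w ≡ false
  disjoint w with zeros w ≡ᵇ y
  ... | false = refl
  ... | true  = ⊔≡ᵇ-disjoint K (maxZeroBlock w)

-- prefixedCount k i m y: strings w of length m with y zeros whose longest
-- zero block becomes exactly k when a block of i zeros is written before w.
prefixedCount : (k i m y : ℕ) → ℕ
prefixedCount k i m y = count m (λ w → (zeros w ≡ᵇ y) ∧ (longestRun i 0 w ≡ᵇ k))

prefixedCount-zero : ∀ k m y → F m y k ≡ prefixedCount k 0 m y
prefixedCount-zero k m y = F≡count m y k

-- After a block of i zeros has been closed by a one, what remains to check
-- is that max(i, longest block of the rest) = k.
closed-block : ∀ k i m y →
  count m (λ w → (zeros w ≡ᵇ y) ∧ (longestRun 0 i w ≡ᵇ k))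
    ≡ count m (λ w → (zeros w ≡ᵇ y) ∧ (i ⊔ maxZeroBlock w ≡ᵇ k))
closed-block k i m y =
  count-ext m _ _ (λ w → cong (λ r → (zeros w ≡ᵇ y) ∧ (r ≡ᵇ k)) (longestRun-best 0 i w))

-- A prefix block of exactly k zeros: the next letter must be a one, after
-- which the rest may have any longest block j ≤ k.
prefixedCount-full : ∀ k m y → prefixedCount k k (suc m) y ≡ Σ< (suc k) (F m y)
prefixedCount-full k m y = cong₂ _+_
  (count-none m _ tooLong)
  (trans (closed-block k k m y) (count-maxZeroBlock≤ m y k))
  where
  tooLong : ∀ w → (suc (zeros w) ≡ᵇ y) ∧ (longestRun (suc k) 0 w ≡ᵇ k) ≡ false
  tooLong w = trans (cong ((suc (zeros w) ≡ᵇ y) ∧_)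
                          (≢⇒≡ᵇ-false (>⇒≢ (current≤longestRun (suc k) 0 w))))
                    (∧-zeroʳ _)

-- A prefix block of i < k zeros: either it grows by one, or it is closed by a
-- one and the rest must itself reach the longest block k.
prefixedCount-short : ∀ k i m y → i < k →
  prefixedCount k i (suc m) (suc y) ≡ prefixedCount k (suc i) m y + F m (suc y) k
prefixedCount-short k i m y i<k = cong (prefixedCount k (suc i) m y +_) (begin
  count m (λ w → (zeros w ≡ᵇ suc y) ∧ (longestRun 0 i w ≡ᵇ k))
    ≡⟨ closed-block k i m (suc y) ⟩
  count m (λ w → (zeros w ≡ᵇ suc y) ∧ (i ⊔ maxZeroBlock w ≡ᵇ k))
    ≡⟨ count-ext m _ _ (λ w → cong ((zeros w ≡ᵇ suc y) ∧_) (⊔≡ᵇ-below i _ k i<k)) ⟩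
  count m (hasShape (suc y) k)
    ≡⟨ sym (F≡count m (suc y) k) ⟩
  F m (suc y) k ∎)
  where open ≡-Reasoning

-- Unrolling the two previous lemmas while the prefix grows from i to k = i + d.
prefixedCount-unroll : ∀ k d i → i + d ≡ k → ∀ m y → d ≤ y → d < m →
  prefixedCount k i m y ≡ Σ< d (λ t → F (m ∸ t ∸ 1) (y ∸ t) k)
                          + Σ< (suc k) (F (m ∸ d ∸ 1) (y ∸ d))
prefixedCount-unroll k zero i i+0≡k (suc m) y _ _
  with refl ← trans (sym (+-identityʳ i)) i+0≡k = prefixedCount-full k m y
prefixedCount-unroll k (suc d) i i+1+d≡k (suc m) (suc y) (s≤s d≤y) (s≤s d<m) = begin
  prefixedCount k i (suc m) (suc y)
    ≡⟨ prefixedCount-short k i m y i<k ⟩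
  prefixedCount k (suc i) m y + F m (suc y) k
    ≡⟨ cong (_+ F m (suc y) k)
            (prefixedCount-unroll k d (suc i) (trans (sym (+-suc i d)) i+1+d≡k) m y d≤y d<m) ⟩
  (shorter + full) + F m (suc y) k
    ≡⟨ +-comm (shorter + full) _ ⟩
  F m (suc y) k + (shorter + full)
    ≡⟨ sym (+-assoc (F m (suc y) k) shorter full) ⟩
  (F m (suc y) k + shorter) + full ∎
  where
  open ≡-Reasoning
  shorter = Σ< d (λ t → F (m ∸ t ∸ 1) (y ∸ t) k)
  full    = Σ< (suc k) (F (m ∸ d ∸ 1) (y ∸ d))
  i<k : i < k
  i<k = ≤-trans (m≤m+n (suc i) d) (≤-reflexive (trans (sym (+-suc i d)) i+1+d≡k))

-- The lower bound ⌊n/(n-x+1)⌋ is positive, so k = 0 never occurs.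
bound-positive : ∀ {n x} → 0 < x → x ≤ n → 0 < n / suc (n ∸ x)
bound-positive {n} 0<x x≤n = m≥n⇒m/n>0 (∸-monoʳ-< {n} 0<x x≤n)

theorem3p2 : (n x k : ℕ) → 3 ≤ n → 1 ≤ x → x ≤ n ∸ 2 →
    n / suc (n ∸ x) ≤ k → k ≤ x →
    F n x k ≡ Σ[0to k ∸ 1 ] (λ i → F (n ∸ i ∸ 1) (x ∸ i) k)
              + Σ[0to k ] (λ j → F (n ∸ k ∸ 1) (x ∸ k) j)
theorem3p2 n x zero _ 1≤x x≤n∸2 bound≤0 _ =
  ⊥-elim (<-irrefl refl (≤-trans (bound-positive 1≤x (≤-trans x≤n∸2 (m∸n≤m n 2))) bound≤0))
theorem3p2 n@(suc (suc n′)) x k@(suc k′) (s≤s (s≤s _)) _ x≤n∸2 _ k≤x = begin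
  F n x k
    ≡⟨ prefixedCount-zero k n x ⟩
  prefixedCount k 0 n x
    ≡⟨ prefixedCount-unroll k k 0 refl n x k≤x k<n ⟩
  Σ< k (λ i → F (n ∸ i ∸ 1) (x ∸ i) k) + Σ< (suc k) (F (n ∸ k ∸ 1) (x ∸ k))
    ≡⟨ sym (cong₂ _+_ (Σ[0to]≡Σ< k′ (λ i → F (n ∸ i ∸ 1) (x ∸ i) k))
                      (Σ[0to]≡Σ< k (F (n ∸ k ∸ 1) (x ∸ k)))) ⟩
  Σ[0to k ∸ 1 ] (λ i → F (n ∸ i ∸ 1) (x ∸ i) k) + Σ[0to k ] (λ j → F (n ∸ k ∸ 1) (x ∸ k) j) ∎
  where
  open ≡-Reasoning
  k<n : k < n
  k<n = ≤-trans (s≤s (≤-trans k≤x x≤n∸2)) (n≤1+n (suc n′))
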